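{- Let $G$ and $H$ be connected graphs of orders $n_1\ge2$ and $n_2\ge2$ respectively, and let $k\ge1$ be an integer (with $G\odot^0H:=G$). Then $Z(G\odot^{k}H)=Z(G\odot^{k-1}H)+n_1(n_2+1)^{k-1}(n_2-1)$ if and only if $H\cong K_{n_2}$.
   Context: Zero forcing: given a set $S$ of initially black vertices (others white), the color-change rule turns a white vertex black if it is the only white neighbor of some black vertex; $S$ is a zero forcing set if eventually all vertices become black; $Z(G)$ is the minimum size of a zero forcing set. Corona: for $G$ of order $n_1$, $G\odot H$ is obtained from $G$ and $n_1$ disjoint copies of $H$ by joining the $i$-th vertex of $G$ to every vertex of the $i$-th copy; $G\odot^1H=G\odot H$, $G\odot^kH=(G\odot^{k-1}H)\odot H$. $K_{n_2}$ is the complete graph on $n_2$ vertices. -}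

module Defs where

open import Data.Nat using (ℕ; zero; suc; _+_; _*_; _≤_)
open import Data.Fin using (Fin; splitAt; remQuot; _≟_)
open import Data.Fin.Subset using (Subset; _∈_; ∣_∣)
open import Data.Bool using (Bool; true; false; not; _∧_)
open import Data.Sum using (inj₁; inj₂)
open import Data.Product using (Σ; _×_; _,_)
open import Function.Bundles using (_↔_; Inverse)
open import Relation.Nullary using (¬_)
open import Relation.Nullary.Decidable using (⌊_⌋)
open import Relation.Binary.PropositionalEquality using (_≡_)

Graph : ℕ → Set
Graph n = Fin n → Fin n → Bool

record IsSimple {n : ℕ} (G : Graph n) : Set where
  field
    symmetric   : ∀ u v → G u v ≡ G v u
    irreflexive : ∀ u → G u u ≡ false

data Reach {n : ℕ} (G : Graph n) : Fin n → Fin n → Set where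
  here : ∀ {u} → Reach G u u
  step : ∀ {u w v} → G u w ≡ true → Reach G w v → Reach G u v

Connected : ∀ {n} → Graph n → Set
Connected {n} G = ∀ (u v : Fin n) → Reach G u v

Complete : (n : ℕ) → Graph n
Complete n u v = not ⌊ u ≟ v ⌋

_≅_ : ∀ {n m} → Graph n → Graph m → Set
_≅_ {n} {m} G G' =
  Σ (Fin n ↔ Fin m) λ f → ∀ u v → G u v ≡ G' (Inverse.to f u) (Inverse.to f v)

-- Corona G ⊙ H. Vertex set Fin (n₁ + n₁ * n₂): the first n₁ vertices are
-- those of G; a vertex j of the second block with remQuot {n₁} n₂ j = (i , h)
-- is vertex h of the i-th copy of H.
corona : ∀ {n₁ n₂} → Graph n₁ → Graph n₂ → Graph (n₁ + n₁ * n₂)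
corona {n₁} {n₂} G H u v with splitAt n₁ u | splitAt n₁ v
... | inj₁ a | inj₁ b = G a b
... | inj₁ a | inj₂ j with remQuot {n₁} n₂ j
...   | (i , h) = ⌊ a ≟ i ⌋
corona {n₁} {n₂} G H u v | inj₂ j | inj₁ a with remQuot {n₁} n₂ j
...   | (i , h) = ⌊ i ≟ a ⌋
corona {n₁} {n₂} G H u v | inj₂ j | inj₂ j' with remQuot {n₁} n₂ j | remQuot {n₁} n₂ j'
...   | (i , h) | (i' , h') = ⌊ i ≟ i' ⌋ ∧ H h h'

coronaOrder : ℕ → ℕ → ℕ → ℕ
coronaOrder n₁ n₂ zero    = n₁
coronaOrder n₁ n₂ (suc k) = coronaOrder n₁ n₂ k + coronaOrder n₁ n₂ k * n₂

coronaIter : ∀ {n₁ n₂} → Graph n₁ → Graph n₂ → (k : ℕ) → Graph (coronaOrder n₁ n₂ k)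
coronaIter G H zero    = G
coronaIter G H (suc k) = corona (coronaIter G H k) H

data Black {n : ℕ} (G : Graph n) (S : Subset n) : Fin n → Set where
  initial : ∀ {v} → v ∈ S → Black G S v
  force   : ∀ {u v} → Black G S u → G u v ≡ true →
            (∀ w → G u w ≡ true → ¬ (w ≡ v) → Black G S w) →
            Black G S v

IsZeroForcingSet : ∀ {n} → Graph n → Subset n → Set
IsZeroForcingSet {n} G S = ∀ (v : Fin n) → Black G S v

IsZeroForcingNumber : ∀ {n} → Graph n → ℕ → Set
IsZeroForcingNumber {n} G z =
  Σ (Subset n) (λ S → IsZeroForcingSet G S × ∣ S ∣ ≡ z)
  × (∀ (S : Subset n) → IsZeroForcingSet G S → z ≤ ∣ S ∣)

-- If T is a zero forcing set of H, then a zero forcing set of G together with a copy of T in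
-- every copy of H forces G ⊙ H: once a hub is black, its copy of H behaves like H itself. So
-- Z(G ⊙ H) ≤ Z(G) + N·|T| with N = |G|, which is Z(G) + N(m − 1) for H = K_m (m = |H|).
-- Conversely, in G ⊙ K_m a copy vertex outside the initial set can only be forced once every
-- other vertex of its copy is black, so each copy holds at least m − 1 initial vertices; and
-- calling a vertex of G black when its hub or its whole copy is initially black projects every
-- forcing chain of G ⊙ K_m onto G. Hence Z(G ⊙ K_m) = Z(G) + N(m − 1). If H is connected but
-- not complete, a walk between two non-adjacent vertices contains an induced path x ~ y ~ w,
-- and V(H) ∖ {y, w} forces H, so Z(G ⊙ H) ≤ Z(G) + N(m − 2). Finally, G ⊙^(k−1) H has
-- n₁(n₂ + 1)^(k−1) vertices.

module Submission where

open import Defs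
open import Data.Nat using (ℕ; zero; suc; _+_; _*_; _∸_; _^_; _≤_; _<_; z≤n; s≤s; >-nonZero)
open import Data.Nat.Properties
  using (+-suc; +-assoc; +-comm; *-identityʳ; ≤-trans; ≤-antisym; ≤-reflexive; <-irrefl;
         n≤1+n; m≤m+n; +-mono-≤; +-monoˡ-≤; +-monoʳ-≤; +-monoʳ-<; *-monoʳ-<; module ≤-Reasoning)
open import Data.Nat.Tactic.RingSolver using (solve-∀)
open import Data.Bool using (Bool; true; false; not; _∧_)
open import Data.Bool.Properties using (T-≡)
open import Data.Fin using (Fin; zero; suc; _↑ˡ_; _↑ʳ_; splitAt; combine; quotRem; remQuot; _≟_)
open import Data.Fin.Properties
  using (splitAt-↑ˡ; splitAt-↑ʳ; splitAt⁻¹-↑ˡ; splitAt⁻¹-↑ʳ; remQuot-combine; combine-remQuot;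
         ↑ˡ-injective; ↑ʳ-injective; combine-injective; all?)
open import Data.Fin.Subset using (Subset; _∈_; _⊂_; _∪_; ∁; ⁅_⁆; ⊤; ∣_∣)
open import Data.Fin.Subset.Properties
  using (_∈?_; ∣⊤∣≡n; ∣⁅x⁆∣≡1; ∣∁p∣≡n∸∣p∣; x∈⁅x⁆; x∈⁅y⁆⇒x≡y; x∉p⇒x∈∁p; x∈∁p⇒x∉p;
         x∈p∪q⁺; x∈p∪q⁻; p⊆p∪q; p⊆q⇒∣p∣≤∣q∣; p⊂q⇒∣p∣<∣q∣; p⊂q⇒∁p⊃∁q)
open import Data.Vec using (Vec; []; _∷_; _++_; concat; replicate; map; sum; lookup; here; there)
import Data.Vec as Vec
open import Data.Vec.Properties
  using (lookup-++ˡ; lookup-++ʳ; lookup-concat; lookup-map; lookup-replicate;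
         []=⇒lookup; lookup⇒[]=)
open import Data.Product using (Σ; _×_; _,_; proj₁; proj₂; swap)
open import Data.Sum using (_⊎_; inj₁; inj₂; [_,_]; map₁)
open import Function using (_∘_; id; const)
open import Function.Bundles using (_⇔_; mk⇔; Inverse; Equivalence)
open import Function.Construct.Identity using (↔-id)
open import Function.Construct.Symmetry using (⇔-sym)
open import Function.Construct.Composition using (_⇔-∘_)
open import Relation.Nullary using (¬_; yes; no; contradiction)
open import Relation.Nullary.Decidable using (⌊_⌋; toWitness; fromWitness)
open import Relation.Binary.PropositionalEquality
  using (_≡_; refl; sym; trans; cong; cong₂; subst)

∣p++q∣≡∣p∣+∣q∣ : ∀ {m n} (p : Subset m) (q : Subset n) → ∣ p ++ q ∣ ≡ ∣ p ∣ + ∣ q ∣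
∣p++q∣≡∣p∣+∣q∣ []          q = refl
∣p++q∣≡∣p∣+∣q∣ (true ∷ p)  q = cong suc (∣p++q∣≡∣p∣+∣q∣ p q)
∣p++q∣≡∣p∣+∣q∣ (false ∷ p) q = ∣p++q∣≡∣p∣+∣q∣ p q

∣concat∣≡sum : ∀ {m n} (ps : Vec (Subset m) n) → ∣ concat ps ∣ ≡ sum (map ∣_∣ ps)
∣concat∣≡sum []       = refl
∣concat∣≡sum (p ∷ ps) = trans (∣p++q∣≡∣p∣+∣q∣ p (concat ps)) (cong (∣ p ∣ +_) (∣concat∣≡sum ps))

∣concat-replicate∣ : ∀ {m} n (p : Subset m) → ∣ concat (replicate n p) ∣ ≡ n * ∣ p ∣
∣concat-replicate∣ zero    p = refl
∣concat-replicate∣ (suc n) p = trans (∣p++q∣≡∣p∣+∣q∣ p _) (cong (∣ p ∣ +_) (∣concat-replicate∣ n p))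

∣p∪q∣≤∣p∣+∣q∣ : ∀ {n} (p q : Subset n) → ∣ p ∪ q ∣ ≤ ∣ p ∣ + ∣ q ∣
∣p∪q∣≤∣p∣+∣q∣ []          []          = z≤n
∣p∪q∣≤∣p∣+∣q∣ (true ∷ p)  (true ∷ q)  =
  s≤s (≤-trans (∣p∪q∣≤∣p∣+∣q∣ p q) (+-monoʳ-≤ ∣ p ∣ (n≤1+n ∣ q ∣)))
∣p∪q∣≤∣p∣+∣q∣ (true ∷ p)  (false ∷ q) = s≤s (∣p∪q∣≤∣p∣+∣q∣ p q)
∣p∪q∣≤∣p∣+∣q∣ (false ∷ p) (true ∷ q)  =
  ≤-trans (s≤s (∣p∪q∣≤∣p∣+∣q∣ p q)) (≤-reflexive (sym (+-suc ∣ p ∣ ∣ q ∣)))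
∣p∪q∣≤∣p∣+∣q∣ (false ∷ p) (false ∷ q) = ∣p∪q∣≤∣p∣+∣q∣ p q

∀∈⇒n≤∣p∣ : ∀ {n} {p : Subset n} → (∀ x → x ∈ p) → n ≤ ∣ p ∣
∀∈⇒n≤∣p∣ {n} {p} all = subst (_≤ ∣ p ∣) (∣⊤∣≡n n) (p⊆q⇒∣p∣≤∣q∣ {p = ⊤} (λ {x} _ → all x))

x≢y⇒x∈∁⁅y⁆ : ∀ {n} {x y : Fin n} → ¬ x ≡ y → x ∈ ∁ ⁅ y ⁆
x≢y⇒x∈∁⁅y⁆ x≢y = x∉p⇒x∈∁p (x≢y ∘ x∈⁅y⁆⇒x≡y _)

x∈∁⁅y⁆⇒x≢y : ∀ {n} {x y : Fin n} → x ∈ ∁ ⁅ y ⁆ → ¬ x ≡ y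
x∈∁⁅y⁆⇒x≢y {y = y} x∈ refl = x∈∁p⇒x∉p x∈ (x∈⁅x⁆ y)

∣∁⁅x⁆∣≡n : ∀ {n} (x : Fin (suc n)) → ∣ ∁ ⁅ x ⁆ ∣ ≡ n
∣∁⁅x⁆∣≡n x = trans (∣∁p∣≡n∸∣p∣ ⁅ x ⁆) (cong (_ ∸_) (∣⁅x⁆∣≡1 x))

∣∁[⁅x⁆∪⁅y⁆]∣<n : ∀ {n} {x y : Fin (suc n)} → ¬ x ≡ y → ∣ ∁ (⁅ x ⁆ ∪ ⁅ y ⁆) ∣ < n
∣∁[⁅x⁆∪⁅y⁆]∣<n {x = x} {y} x≢y =
  subst (∣ ∁ (⁅ x ⁆ ∪ ⁅ y ⁆) ∣ <_) (∣∁⁅x⁆∣≡n x) (p⊂q⇒∣p∣<∣q∣ (p⊂q⇒∁p⊃∁q ⁅x⁆⊂⁅x⁆∪⁅y⁆))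
  where
    ⁅x⁆⊂⁅x⁆∪⁅y⁆ : ⁅ x ⁆ ⊂ ⁅ x ⁆ ∪ ⁅ y ⁆
    ⁅x⁆⊂⁅x⁆∪⁅y⁆ = p⊆p∪q _ , y , x∈p∪q⁺ (inj₂ (x∈⁅x⁆ y)) , x≢y ∘ sym ∘ x∈⁅y⁆⇒x≡y x

∀-distrib-⊎ʳ : ∀ {n} {P : Fin n → Set} {Q : Set} → (∀ x → P x ⊎ Q) → (∀ x → P x) ⊎ Q
∀-distrib-⊎ʳ {zero}  k = inj₁ λ ()
∀-distrib-⊎ʳ {suc n} k with k zero | ∀-distrib-⊎ʳ (k ∘ suc)
... | inj₂ q  | _        = inj₂ q
... | inj₁ _  | inj₂ q   = inj₂ q
... | inj₁ p₀ | inj₁ pₛ  = inj₁ λ { zero → p₀ ; (suc x) → pₛ x }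

∁⁅x⁆⊆p⇒n≤∣p∣ : ∀ {n} {p : Subset (suc n)} x → (∀ y → ¬ y ≡ x → y ∈ p) → n ≤ ∣ p ∣
∁⁅x⁆⊆p⇒n≤∣p∣ {p = p} x all = subst (_≤ ∣ p ∣) (∣∁⁅x⁆∣≡n x) (p⊆q⇒∣p∣≤∣q∣ λ {y} → all y ∘ x∈∁⁅y⁆⇒x≢y)

allButOne⇒n≤∣p∣ : ∀ {n} (p : Subset (suc n)) x → (∀ y → ¬ y ≡ x → y ∈ p ⊎ n ≤ ∣ p ∣) → n ≤ ∣ p ∣
allButOne⇒n≤∣p∣ {n} p x in-or-bound = [ ∁⁅x⁆⊆p⇒n≤∣p∣ x , id ] (∀-distrib-⊎ʳ in-or-bound′)
  where
    in-or-bound′ : ∀ y → (¬ y ≡ x → y ∈ p) ⊎ n ≤ ∣ p ∣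
    in-or-bound′ y with y ≟ x
    ... | yes y≡x = inj₁ λ y≢x → contradiction y≡x y≢x
    ... | no  y≢x = map₁ const (in-or-bound y y≢x)

sum-lowerBound : ∀ {m n} (xs : Vec ℕ n) (fs : Subset n) →
  (∀ i → m ≤ lookup xs i) → (∀ {i} → i ∈ fs → suc m ≤ lookup xs i) →
  n * m + ∣ fs ∣ ≤ sum xs
sum-lowerBound []       []           _  _       = z≤n
sum-lowerBound {m} {suc n} (x ∷ xs) (true ∷ fs) lb flagged = begin
  m + n * m + suc ∣ fs ∣   ≡⟨ trans (+-suc (m + n * m) _) (cong suc (+-assoc m (n * m) _)) ⟩
  suc m + (n * m + ∣ fs ∣)
    ≤⟨ +-mono-≤ (flagged here) (sum-lowerBound xs fs (lb ∘ suc) (flagged ∘ there)) ⟩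
  x + sum xs               ∎
  where open ≤-Reasoning
sum-lowerBound {m} {suc n} (x ∷ xs) (false ∷ fs) lb flagged = begin
  m + n * m + ∣ fs ∣   ≡⟨ +-assoc m (n * m) _ ⟩
  m + (n * m + ∣ fs ∣) ≤⟨ +-mono-≤ (lb zero) (sum-lowerBound xs fs (lb ∘ suc) (flagged ∘ there)) ⟩
  x + sum xs           ∎
  where open ≤-Reasoning

≟-true⇒≡ : ∀ {n} {a b : Fin n} → ⌊ a ≟ b ⌋ ≡ true → a ≡ b
≟-true⇒≡ {a = a} {b} eq with a ≟ b
... | yes a≡b = a≡b

≟-refl : ∀ {n} (a : Fin n) → ⌊ a ≟ a ⌋ ≡ true
≟-refl a with a ≟ a
... | yes _  = refl
... | no a≢a = contradiction refl a≢a

≢⇒not-≟ : ∀ {n} {a b : Fin n} → ¬ a ≡ b → not ⌊ a ≟ b ⌋ ≡ true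
≢⇒not-≟ {a = a} {b} a≢b with a ≟ b
... | yes a≡b = contradiction a≡b a≢b
... | no  _   = refl

IsComplete : ∀ {n} → Graph n → Set
IsComplete {n} H = ∀ (x y : Fin n) → ¬ x ≡ y → H x y ≡ true

adjacent⇒≢ : ∀ {n} {H : Graph n} → IsSimple H → ∀ {x y} → H x y ≡ true → ¬ x ≡ y
adjacent⇒≢ H-simple {x} x~x refl =
  contradiction (trans (sym x~x) (IsSimple.irreflexive H-simple x)) λ ()

≅-Complete⇔IsComplete : ∀ {n} {H : Graph n} → IsSimple H → H ≅ Complete n ⇔ IsComplete H
≅-Complete⇔IsComplete {n} {H} H-simple = mk⇔ complete ≅-id
  where
    complete : H ≅ Complete n → IsComplete H
    complete (f , f-hom) x y x≢y = trans (f-hom x y) (≢⇒not-≟ (x≢y ∘ injective))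
      where
        open Inverse f
        injective : ∀ {x y} → to x ≡ to y → x ≡ y
        injective {x} {y} eq =
          trans (sym (strictlyInverseʳ x)) (trans (cong from eq) (strictlyInverseʳ y))
    ≅-id : IsComplete H → H ≅ Complete n
    ≅-id H-complete = ↔-id _ , adj
      where
        adj : ∀ u v → H u v ≡ Complete n u v
        adj u v with u ≟ v
        ... | yes refl = IsSimple.irreflexive H-simple u
        ... | no  u≢v  = H-complete u v u≢v

allButOne-zeroForcingSet : ∀ {n} {H : Graph n} {u v} → H u v ≡ true → ¬ u ≡ v →
  IsZeroForcingSet H (∁ ⁅ v ⁆)
allButOne-zeroForcingSet {v = v} u~v u≢v w with w ≟ v
... | yes refl = force (initial (x≢y⇒x∈∁⁅y⁆ u≢v)) u~v λ w' _ w'≢v → initial (x≢y⇒x∈∁⁅y⁆ w'≢v)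
... | no  w≢v  = initial (x≢y⇒x∈∁⁅y⁆ w≢v)

record InducedPath₃ {n} (H : Graph n) : Set where
  field
    x y w : Fin n
    x~y   : H x y ≡ true
    y~w   : H y w ≡ true
    x≁w   : H x w ≡ false
    x≢w   : ¬ x ≡ w

inducedPath₃ : ∀ {n} {H : Graph n} {a b} → Reach H a b → ¬ a ≡ b → H a b ≡ false → InducedPath₃ H
inducedPath₃ here a≢b _ = contradiction refl a≢b
inducedPath₃ {H = H} (step {a} {p} {b} a~p p⇝b) a≢b a≁b with p ≟ b
... | yes refl = contradiction (trans (sym a~p) a≁b) λ ()
... | no  p≢b with H p b in p~b
...   | true  = record { x = a ; y = p ; w = b ; x~y = a~p ; y~w = p~b ; x≁w = a≁b ; x≢w = a≢b }
...   | false = inducedPath₃ p⇝b p≢b p~b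

module _ {n} {H : Graph n} (H-simple : IsSimple H) (P : InducedPath₃ H) where
  open InducedPath₃ P

  private
    ∈∁⁅y⁆∪⁅w⁆ : ∀ {v} → ¬ v ≡ y → ¬ v ≡ w → v ∈ ∁ (⁅ y ⁆ ∪ ⁅ w ⁆)
    ∈∁⁅y⁆∪⁅w⁆ v≢y v≢w = x∉p⇒x∈∁p ([ v≢y ∘ x∈⁅y⁆⇒x≡y y , v≢w ∘ x∈⁅y⁆⇒x≡y w ] ∘ x∈p∪q⁻ _ _)

    y-black : Black H (∁ (⁅ y ⁆ ∪ ⁅ w ⁆)) y
    y-black = force (initial (∈∁⁅y⁆∪⁅w⁆ (adjacent⇒≢ H-simple x~y) x≢w)) x~y
      λ v x~v v≢y → initial (∈∁⁅y⁆∪⁅w⁆ v≢y λ { refl → contradiction (trans (sym x~v) x≁w) λ () })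

    w-black : Black H (∁ (⁅ y ⁆ ∪ ⁅ w ⁆)) w
    w-black = force y-black y~w λ v _ v≢w → neighbour-black v v≢w
      where
        neighbour-black : ∀ v → ¬ v ≡ w → Black H (∁ (⁅ y ⁆ ∪ ⁅ w ⁆)) v
        neighbour-black v v≢w with v ≟ y
        ... | yes refl = y-black
        ... | no  v≢y  = initial (∈∁⁅y⁆∪⁅w⁆ v≢y v≢w)

  inducedPath₃-zeroForcingSet : IsZeroForcingSet H (∁ (⁅ y ⁆ ∪ ⁅ w ⁆))
  inducedPath₃-zeroForcingSet v with v ≟ y | v ≟ w
  ... | yes refl | _        = y-black
  ... | no  _    | yes refl = w-black
  ... | no  v≢y  | no  v≢w  = initial (∈∁⁅y⁆∪⁅w⁆ v≢y v≢w)

  inducedPath₃-y≢w : ¬ y ≡ w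
  inducedPath₃-y≢w = adjacent⇒≢ H-simple y~w

∈-resp-lookup : ∀ {m n} {p : Subset m} {q : Subset n} {x y} →
  lookup p x ≡ lookup q y → x ∈ p → y ∈ q
∈-resp-lookup {q = q} {y = y} eq x∈p = lookup⇒[]= y q (trans (sym eq) ([]=⇒lookup x∈p))

module CoronaVertices {N m : ℕ} (G : Graph N) (H : Graph m) where

  hub : Fin N → Fin (N + N * m)
  hub a = a ↑ˡ (N * m)

  copy : Fin N → Fin m → Fin (N + N * m)
  copy i h = N ↑ʳ combine i h

  data View : Fin (N + N * m) → Set where
    isHub  : ∀ a → View (hub a)
    isCopy : ∀ i h → View (copy i h)

  view : ∀ u → View u
  view u with splitAt N u in eq
  ... | inj₁ a = subst View (splitAt⁻¹-↑ˡ eq) (isHub a)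
  ... | inj₂ j = subst View (trans (cong (N ↑ʳ_) (combine-remQuot {N} m j)) (splitAt⁻¹-↑ʳ eq))
                   (isCopy (proj₁ (remQuot {N} m j)) (proj₂ (remQuot {N} m j)))

  hub-injective : ∀ {a b} → hub a ≡ hub b → a ≡ b
  hub-injective = ↑ˡ-injective (N * m) _ _

  copy-injective : ∀ {i h i' h'} → copy i h ≡ copy i' h' → i ≡ i' × h ≡ h'
  copy-injective = combine-injective _ _ _ _ ∘ ↑ʳ-injective N _ _

  hub≢copy : ∀ {a i h} → ¬ hub a ≡ copy i h
  hub≢copy {a} {i} {h} eq
    with () ← trans (sym (splitAt-↑ˡ N a (N * m)))
                    (trans (cong (splitAt N) eq) (splitAt-↑ʳ N (N * m) (combine i h)))

  C : Graph (N + N * m)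
  C = corona G H

  private
    -- corona's with-clauses normalise remQuot to a swapped quotRem
    quotRem-combine : ∀ i h → quotRem {N} m (combine i h) ≡ (h , i)
    quotRem-combine i h = cong swap (remQuot-combine i h)

    adj-hub-copy : ∀ a i h → C (hub a) (copy i h) ≡ ⌊ a ≟ i ⌋
    adj-hub-copy a i h rewrite splitAt-↑ˡ N a (N * m) | splitAt-↑ʳ N (N * m) (combine i h)
                             | quotRem-combine i h = refl

    adj-copy-hub : ∀ i h a → C (copy i h) (hub a) ≡ ⌊ i ≟ a ⌋
    adj-copy-hub i h a rewrite splitAt-↑ˡ N a (N * m) | splitAt-↑ʳ N (N * m) (combine i h)
                             | quotRem-combine i h = refl

    adj-copy-copy : ∀ i h i' h' → C (copy i h) (copy i' h') ≡ ⌊ i ≟ i' ⌋ ∧ H h h'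
    adj-copy-copy i h i' h'
      rewrite splitAt-↑ʳ N (N * m) (combine i h) | splitAt-↑ʳ N (N * m) (combine i' h')
            | quotRem-combine i h | quotRem-combine i' h' = refl

  adj-hub-hub : ∀ a b → C (hub a) (hub b) ≡ G a b
  adj-hub-hub a b rewrite splitAt-↑ˡ N a (N * m) | splitAt-↑ˡ N b (N * m) = refl

  hub~copy : ∀ i h → C (hub i) (copy i h) ≡ true
  hub~copy i h = trans (adj-hub-copy i i h) (≟-refl i)

  copy~hub : ∀ i h → C (copy i h) (hub i) ≡ true
  copy~hub i h = trans (adj-copy-hub i h i) (≟-refl i)

  copy~copy : ∀ i {h h'} → H h h' ≡ true → C (copy i h) (copy i h') ≡ true
  copy~copy i {h} {h'} e rewrite adj-copy-copy i h i h' | ≟-refl i = e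

  hub~copy⁻ : ∀ {a i h} → C (hub a) (copy i h) ≡ true → a ≡ i
  hub~copy⁻ {a} {i} {h} e = ≟-true⇒≡ (trans (sym (adj-hub-copy a i h)) e)

  copy~hub⁻ : ∀ {i h a} → C (copy i h) (hub a) ≡ true → i ≡ a
  copy~hub⁻ {i} {h} {a} e = ≟-true⇒≡ (trans (sym (adj-copy-hub i h a)) e)

  copy~copy⁻ : ∀ {i h i' h'} → C (copy i h) (copy i' h') ≡ true → i ≡ i' × H h h' ≡ true
  copy~copy⁻ {i} {h} {i'} {h'} e with ⌊ i ≟ i' ⌋ in i≟i' | trans (sym (adj-copy-copy i h i' h')) e
  ... | true | h~h' = ≟-true⇒≡ i≟i' , h~h'

  module _ (hubs : Subset N) (copies : Vec (Subset m) N) where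
    private
      lookup-copy : ∀ i h → lookup (hubs ++ concat copies) (copy i h) ≡ lookup (lookup copies i) h
      lookup-copy i h =
        trans (lookup-++ʳ hubs (concat copies) (combine i h)) (lookup-concat copies i h)

    hub∈⁺ : ∀ {a} → a ∈ hubs → hub a ∈ hubs ++ concat copies
    hub∈⁺ = ∈-resp-lookup (sym (lookup-++ˡ hubs (concat copies) _))

    hub∈⁻ : ∀ {a} → hub a ∈ hubs ++ concat copies → a ∈ hubs
    hub∈⁻ = ∈-resp-lookup (lookup-++ˡ hubs (concat copies) _)

    copy∈⁺ : ∀ {i h} → h ∈ lookup copies i → copy i h ∈ hubs ++ concat copies
    copy∈⁺ = ∈-resp-lookup (sym (lookup-copy _ _))

    copy∈⁻ : ∀ {i h} → copy i h ∈ hubs ++ concat copies → h ∈ lookup copies i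
    copy∈⁻ = ∈-resp-lookup (lookup-copy _ _)

module _ {N m : ℕ} {G : Graph N} {H : Graph m} {S : Subset N} {T : Subset m} where
  open CoronaVertices G H

  private
    X : Subset (N + N * m)
    X = S ++ concat (replicate N T)

    liftCopy : ∀ {i h} → Black C X (hub i) → Black H T h → Black C X (copy i h)
    liftCopy {i} _ (initial h∈T) =
      initial (copy∈⁺ S (replicate N T) (subst (_ ∈_) (sym (lookup-replicate i T)) h∈T))
    liftCopy {i} hub-black (force {u} {v} u-black u~v others) =
      force (liftCopy hub-black u-black) (copy~copy i u~v) neighbour-black
      where
        neighbour-black : ∀ w → C (copy i u) w ≡ true → ¬ w ≡ copy i v → Black C X w
        neighbour-black w u~w w≢v with view w
        ... | isHub a with refl ← copy~hub⁻ u~w = hub-black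
        ... | isCopy _ h with refl , u~h ← copy~copy⁻ u~w =
          liftCopy hub-black (others h u~h (w≢v ∘ cong (copy i)))

    liftHub : IsZeroForcingSet H T → ∀ {a} → Black G S a → Black C X (hub a)
    liftHub _ (initial a∈S) = initial (hub∈⁺ S (replicate N T) a∈S)
    liftHub T-zfs (force {u} {v} u-black u~v others) =
      force (liftHub T-zfs u-black) (trans (adj-hub-hub u v) u~v) neighbour-black
      where
        neighbour-black : ∀ w → C (hub u) w ≡ true → ¬ w ≡ hub v → Black C X w
        neighbour-black w u~w w≢v with view w
        ... | isHub b =
          liftHub T-zfs (others b (trans (sym (adj-hub-hub u b)) u~w) (w≢v ∘ cong hub))
        ... | isCopy _ h with refl ← hub~copy⁻ u~w = liftCopy (liftHub T-zfs u-black) (T-zfs h)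

  corona-zeroForcingSet : IsZeroForcingSet G S → IsZeroForcingSet H T →
    IsZeroForcingSet (corona G H) (S ++ concat (replicate N T))
  corona-zeroForcingSet S-zfs T-zfs u with view u
  ... | isHub a    = liftHub T-zfs (S-zfs a)
  ... | isCopy i h = liftCopy (liftHub T-zfs (S-zfs i)) (T-zfs h)

full : ∀ {n} → Subset n → Bool
full p = ⌊ all? (_∈? p) ⌋

full⇒∀∈ : ∀ {n} {p : Subset n} → full p ≡ true → ∀ x → x ∈ p
full⇒∀∈ = toWitness ∘ Equivalence.from T-≡

∀∈⇒full : ∀ {n} {p : Subset n} → (∀ x → x ∈ p) → full p ≡ true
∀∈⇒full = Equivalence.to T-≡ ∘ fromWitness

module CoronaLowerBound {N m : ℕ} {G : Graph N} {H : Graph (suc m)} (H-complete : IsComplete H)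
         (hubs : Subset N) (copies : Vec (Subset (suc m)) N) where
  open CoronaVertices G H

  private
    X : Subset (N + N * suc m)
    X = hubs ++ concat copies

    SG : Subset N
    SG = hubs ∪ map full copies

    full-copy∈SG : ∀ {i} → (∀ h → h ∈ lookup copies i) → i ∈ SG
    full-copy∈SG {i} all =
      x∈p∪q⁺ (inj₂ (lookup⇒[]= i _ (trans (lookup-map i full copies) (∀∈⇒full all))))

    mutual
      lowerHub : ∀ {v} → Black C X v → ∀ {a} → v ≡ hub a → Black G SG a
      lowerHub (initial v∈X) refl = initial (x∈p∪q⁺ (inj₁ (hub∈⁻ hubs copies v∈X)))
      lowerHub (force {u} u-black u~v others) {a} refl with view u
      ... | isHub b = force (lowerHub u-black refl) (trans (sym (adj-hub-hub b a)) u~v)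
          λ c b~c c≢a → lowerHub (others (hub c) (trans (adj-hub-hub b c) b~c) (c≢a ∘ hub-injective)) refl
      ... | isCopy i h with refl ← copy~hub⁻ u~v =
        [ initial ∘ full-copy∈SG , id ] (∀-distrib-⊎ʳ copyVertex)
        where
          copyVertex : ∀ h' → h' ∈ lookup copies i ⊎ Black G SG i
          copyVertex h' with h' ≟ h
          ... | yes refl = lowerCopy u-black refl
          ... | no  h'≢h =
            lowerCopy (others (copy i h') (copy~copy i (H-complete h h' (h'≢h ∘ sym))) (hub≢copy ∘ sym)) refl

      lowerCopy : ∀ {v} → Black C X v → ∀ {i h} → v ≡ copy i h → h ∈ lookup copies i ⊎ Black G SG i
      lowerCopy (initial v∈X) refl = inj₁ (copy∈⁻ hubs copies v∈X)
      lowerCopy (force {u} u-black u~v others) {i} refl with view u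
      ... | isHub _ with refl ← hub~copy⁻ u~v = inj₂ (lowerHub u-black refl)
      ... | isCopy _ x with refl , _ ← copy~copy⁻ u~v =
        inj₂ (lowerHub (others (hub i) (copy~hub i x) hub≢copy) refl)

    copyAlmostFull : ∀ {v} → Black C X v → ∀ {i h} → v ≡ copy i h →
      h ∈ lookup copies i ⊎ m ≤ ∣ lookup copies i ∣
    copyAlmostFull (initial v∈X) refl = inj₁ (copy∈⁻ hubs copies v∈X)
    copyAlmostFull (force {u} u-black u~v others) {i} {h} refl with view u
    ... | isHub _ with refl ← hub~copy⁻ u~v =
      inj₂ (allButOne⇒n≤∣p∣ _ h λ h' h'≢h →
        copyAlmostFull (others (copy i h') (hub~copy i h') (h'≢h ∘ proj₂ ∘ copy-injective)) refl)
    ... | isCopy _ x with refl , _ ← copy~copy⁻ u~v = inj₂ (allButOne⇒n≤∣p∣ _ h copyVertex)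
      where
        copyVertex : ∀ h' → ¬ h' ≡ h → h' ∈ lookup copies i ⊎ m ≤ ∣ lookup copies i ∣
        copyVertex h' h'≢h with h' ≟ x
        ... | yes refl = copyAlmostFull u-black refl
        ... | no  h'≢x = copyAlmostFull (others (copy i h') (copy~copy i (H-complete x h' (h'≢x ∘ sym)))
                                                 (h'≢h ∘ proj₂ ∘ copy-injective)) refl

  lowerBound : IsZeroForcingSet (corona G H) X →
    Σ (Subset N) λ SG → IsZeroForcingSet G SG × ∣ SG ∣ + N * m ≤ ∣ X ∣
  lowerBound X-zfs = SG , (λ a → lowerHub (X-zfs (hub a)) refl) , (begin
    ∣ SG ∣ + N * m
      ≤⟨ +-monoˡ-≤ (N * m) (∣p∪q∣≤∣p∣+∣q∣ hubs (map full copies)) ⟩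
    ∣ hubs ∣ + ∣ map full copies ∣ + N * m
      ≡⟨ trans (+-assoc ∣ hubs ∣ _ _) (cong (∣ hubs ∣ +_) (+-comm _ (N * m))) ⟩
    ∣ hubs ∣ + (N * m + ∣ map full copies ∣)
      ≤⟨ +-monoʳ-≤ ∣ hubs ∣ (sum-lowerBound (map ∣_∣ copies) (map full copies) copy-size full-size) ⟩
    ∣ hubs ∣ + sum (map ∣_∣ copies)
      ≡⟨ cong (∣ hubs ∣ +_) (sym (∣concat∣≡sum copies)) ⟩
    ∣ hubs ∣ + ∣ concat copies ∣
      ≡⟨ sym (∣p++q∣≡∣p∣+∣q∣ hubs (concat copies)) ⟩
    ∣ hubs ++ concat copies ∣
      ∎)
    where
      open ≤-Reasoning
      copy-size : ∀ i → m ≤ lookup (map ∣_∣ copies) i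
      copy-size i rewrite lookup-map i ∣_∣ copies =
        [ (λ all → ≤-trans (n≤1+n m) (∀∈⇒n≤∣p∣ all)) , id ]
          (∀-distrib-⊎ʳ λ h → copyAlmostFull (X-zfs (copy i h)) refl)
      full-size : ∀ {i} → i ∈ map full copies → suc m ≤ lookup (map ∣_∣ copies) i
      full-size {i} i∈ rewrite lookup-map i ∣_∣ copies =
        ∀∈⇒n≤∣p∣ (full⇒∀∈ (trans (sym (lookup-map i full copies)) ([]=⇒lookup i∈)))

corona-zeroForcingSet⁻ : ∀ {N m} {G : Graph N} {H : Graph (suc m)} → IsComplete H →
  ∀ {S} → IsZeroForcingSet (corona G H) S →
  Σ (Subset N) λ SG → IsZeroForcingSet G SG × ∣ SG ∣ + N * m ≤ ∣ S ∣
corona-zeroForcingSet⁻ {N} {m} H-complete {S} S-zfs with Vec.splitAt N S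
... | hubs , rest , refl with Vec.group N (suc m) rest
...   | copies , refl = CoronaLowerBound.lowerBound H-complete hubs copies S-zfs

corona-upperBound : ∀ {N m} {G : Graph N} {H : Graph m} {z z' T} →
  IsZeroForcingNumber (corona G H) z → IsZeroForcingNumber G z' → IsZeroForcingSet H T →
  z ≤ z' + N * ∣ T ∣
corona-upperBound {N} {T = T} (_ , z-min) ((S' , S'-zfs , ∣S'∣≡z') , _) T-zfs = begin
  _                                   ≤⟨ z-min _ (corona-zeroForcingSet S'-zfs T-zfs) ⟩
  ∣ S' ++ concat (replicate N T) ∣    ≡⟨ ∣p++q∣≡∣p∣+∣q∣ S' _ ⟩
  ∣ S' ∣ + ∣ concat (replicate N T) ∣ ≡⟨ cong₂ _+_ ∣S'∣≡z' (∣concat-replicate∣ N T) ⟩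
  _ + N * ∣ T ∣                       ∎
  where open ≤-Reasoning

corona-lowerBound : ∀ {N m} {G : Graph N} {H : Graph (suc m)} {z z'} →
  IsZeroForcingNumber (corona G H) z → IsZeroForcingNumber G z' → IsComplete H →
  z' + N * m ≤ z
corona-lowerBound {N} {m} {G} ((S , S-zfs , ∣S∣≡z) , _) (_ , z'-min) H-complete
  with SG , SG-zfs , SG-bound ← corona-zeroForcingSet⁻ {G = G} H-complete S-zfs = begin
  _ + N * m      ≤⟨ +-monoˡ-≤ (N * m) (z'-min SG SG-zfs) ⟩
  ∣ SG ∣ + N * m ≤⟨ SG-bound ⟩
  ∣ S ∣          ≡⟨ ∣S∣≡z ⟩
  _              ∎
  where open ≤-Reasoning

corona-gap⇔complete : ∀ {N m} {G : Graph N} {H : Graph (suc (suc m))} →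
  1 ≤ N → IsSimple H → Connected H →
  ∀ {z z'} → IsZeroForcingNumber (corona G H) z → IsZeroForcingNumber G z' →
  (z ≡ z' + N * suc m) ⇔ IsComplete H
corona-gap⇔complete {N} {m} {H = H} 1≤N H-simple H-connected {z} {z'} z-def z'-def =
  mk⇔ gap⇒complete complete⇒gap
  where
    complete⇒gap : IsComplete H → z ≡ z' + N * suc m
    complete⇒gap H-complete = ≤-antisym
      (subst (λ t → z ≤ z' + N * t) (∣∁⁅x⁆∣≡n (suc zero)) (corona-upperBound z-def z'-def
        (allButOne-zeroForcingSet (H-complete zero (suc zero) λ ()) λ ())))
      (corona-lowerBound z-def z'-def H-complete)

    gap⇒complete : z ≡ z' + N * suc m → IsComplete H
    gap⇒complete gap x y x≢y with H x y in x~y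
    ... | true  = refl
    ... | false = contradiction (begin-strict
        z              ≤⟨ corona-upperBound z-def z'-def (inducedPath₃-zeroForcingSet H-simple P) ⟩
        z' + N * ∣ T ∣ <⟨ +-monoʳ-< z' (*-monoʳ-< N {{>-nonZero 1≤N}} ∣T∣<) ⟩
        z' + N * suc m ∎) (<-irrefl gap)
      where
        open ≤-Reasoning
        P : InducedPath₃ H
        P = inducedPath₃ (H-connected x y) x≢y x~y
        T : Subset (suc (suc m))
        T = ∁ (⁅ InducedPath₃.y P ⁆ ∪ ⁅ InducedPath₃.w P ⁆)
        ∣T∣< : ∣ T ∣ < suc m
        ∣T∣< = ∣∁[⁅x⁆∪⁅y⁆]∣<n (inducedPath₃-y≢w H-simple P)

coronaOrder≡ : ∀ n₁ n₂ k → coronaOrder n₁ n₂ k ≡ n₁ * (n₂ + 1) ^ k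
coronaOrder≡ n₁ n₂ zero    = sym (*-identityʳ n₁)
coronaOrder≡ n₁ n₂ (suc k) rewrite coronaOrder≡ n₁ n₂ k = distribute n₁ ((n₂ + 1) ^ k) n₂
  where
    distribute : ∀ n p m → n * p + n * p * m ≡ n * ((m + 1) * p)
    distribute = solve-∀

coronaOrder-positive : ∀ {n₁} n₂ k → 1 ≤ n₁ → 1 ≤ coronaOrder n₁ n₂ k
coronaOrder-positive n₂ zero    1≤n₁ = 1≤n₁
coronaOrder-positive n₂ (suc k) 1≤n₁ = ≤-trans (coronaOrder-positive n₂ k 1≤n₁) (m≤m+n _ _)

mainTheorem12 : ∀ {n₁ n₂ : ℕ} (G : Graph n₁) (H : Graph n₂) →
    2 ≤ n₁ → 2 ≤ n₂ → IsSimple G → IsSimple H → Connected G → Connected H →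
    ∀ (k : ℕ) → 1 ≤ k → ∀ (z z' : ℕ) →
    IsZeroForcingNumber (coronaIter G H k) z →
    IsZeroForcingNumber (coronaIter G H (k ∸ 1)) z' →
    (z ≡ z' + n₁ * (n₂ + 1) ^ (k ∸ 1) * (n₂ ∸ 1)) ⇔ (H ≅ Complete n₂)
mainTheorem12 {n₁} {n₂@(suc (suc m))} G H 2≤n₁ (s≤s (s≤s _)) _ H-simple _ H-connected
              (suc k) (s≤s z≤n) z z' z-def z'-def =
  subst (λ N → (z ≡ z' + N * suc m) ⇔ (H ≅ Complete n₂)) (coronaOrder≡ n₁ n₂ k)
    (⇔-sym (≅-Complete⇔IsComplete H-simple) ⇔-∘
      corona-gap⇔complete (coronaOrder-positive _ k (≤-trans (s≤s z≤n) 2≤n₁))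
        H-simple H-connected z-def z'-def)
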